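{- Let $S$ be a star graph on $n\ge 1$ vertices (one central vertex adjacent to $n-1$ pendant vertices). Then $S$ has an orientation that is $(2,3)$-cordial if and only if $n\le 11$ and $n\neq 10$.
   Context: A $(0,1)$-labeling $f$ of a finite set $Z$ is friendly if $-1\le |f^{ -1}(0)|-|f^{ -1}(1)|\le 1$; more generally, a labeling $h:Z\to \mathcal{A}$ is friendly if $-1\le |h^{ -1}(i)|-|h^{ -1}(j)|\le 1$ for all $i,j\in\mathcal{A}$. For a digraph $D=(V,A)$ without loops, multiple arcs or digons, and a friendly labeling $f:V\to\{0,1\}$, the induced arc labeling is $g:A\to\{1,0,-1\}$, $g(\overrightarrow{uv})=f(v)-f(u)$ for the arc directed from $u$ to $v$. The labeling is $(2,3)$-cordial if $g$ is friendly (the numbers of arcs labeled $1$, $0$, $-1$ pairwise differ by at most $1$), and $D$ is a $(2,3)$-cordial digraph if it admits such a friendly vertex labeling $f$. An orientation of a graph assigns a direction to each edge. -}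

module Defs where

open import Data.Nat using (ℕ; zero; suc; _≤_)
open import Data.Fin using (Fin; zero; suc)
open import Data.Bool using (Bool; true; false)
open import Data.Product using (_×_; _,_; Σ; proj₁; proj₂)
open import Data.List using (List; []; _∷_; length; filter; map)
open import Data.Vec.Functional using (Vector)
open import Data.Fin.Properties using (_≟_)
open import Data.Integer using (ℤ; _-_; +_)
import Data.Integer.Properties as ℤP
open import Relation.Nullary.Decidable using (⌊_⌋)

Close : ℕ → ℕ → Set
Close a b = (a ≤ suc b) × (b ≤ suc a)

-- number of elements of Fin k receiving a given 0/1-label (false = 0, true = 1)
countLabel : {k : ℕ} → (Fin k → Bool) → Bool → ℕ
countLabel {k} f b =
  length (filter (λ v → Data.Bool._≟_ (f v) b) (Data.List.allFin k))

FriendlyV : {k : ℕ} → (Fin k → Bool) → Set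
FriendlyV f = Close (countLabel f false) (countLabel f true)

-- a digraph on vertex set Fin k given by its list of arcs (u , v) meaning u → v
Digraph : ℕ → Set
Digraph k = List (Fin k × Fin k)

val : Bool → ℤ
val false = + 0
val true  = + 1

arcLabel : {k : ℕ} → (Fin k → Bool) → Fin k × Fin k → ℤ
arcLabel f (u , v) = val (f v) - val (f u)

countArc : {k : ℕ} → (Fin k → Bool) → Digraph k → ℤ → ℕ
countArc f A c = length (filter (λ a → ℤP._≟_ (arcLabel f a) c) A)

Cordial23Labeling : {k : ℕ} → Digraph k → (Fin k → Bool) → Set
Cordial23Labeling A f =
  FriendlyV f ×
  Close (countArc f A (+ 1)) (countArc f A (+ 0)) ×
  Close (countArc f A (+ 1)) (countArc f A (Data.Integer.-[1+ 0 ])) ×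
  Close (countArc f A (+ 0)) (countArc f A (Data.Integer.-[1+ 0 ]))

Cordial23 : {k : ℕ} → Digraph k → Set
Cordial23 {k} A = Σ (Fin k → Bool) (Cordial23Labeling A)

-- star graph on suc m vertices: centre zero, leaves suc i (i : Fin m).
-- An orientation chooses for each leaf edge a direction:
-- o i = true means centre → leaf, false means leaf → centre.
starOrientation : (m : ℕ) → (Fin m → Bool) → Digraph (suc m)
starOrientation m o = map arc (Data.List.allFin m)
  where
  arc : Fin m → Fin (suc m) × Fin (suc m)
  arc i with o i
  ... | true  = (zero , suc i)
  ... | false = (suc i , zero)

StarHasCordialOrientation : (n : ℕ) → Set
StarHasCordialOrientation zero = Data.Empty.⊥ where import Data.Empty
StarHasCordialOrientation (suc m) =
  Σ (Fin m → Bool) (λ o → Cordial23 (starOrientation m o))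

{-# OPTIONS --safe #-}
-- Let c be the label of the centre. A leaf labelled c carries an arc labelled 0, every other leaf an
-- arc labelled 1 or -1 depending on its orientation; so with z leaves agreeing and w disagreeing with
-- the centre, z arcs are labelled 0 and the arcs labelled ±1 split w. Balancing the arc labels forces
-- 2z ≤ w + 2, friendliness of the vertex labels forces w ≤ z + 2. Hence z ≤ 4 and the number of leaves
-- z + w is at most 10, and it cannot be 9, which would need z = 4, w = 5. Every other size up to 10
-- is realised by an explicit labelling, verified by computation.
module Submission where

open import Defs
open import Data.Nat using (ℕ; zero; suc; _+_; _≤_; s≤s; s≤s⁻¹; _≤?_; _<ᵇ_)
open import Data.Nat.Properties
  using (+-suc; suc-injective; +-comm; +-cancelʳ-≡; +-cancelʳ-≤; +-mono-≤; +-monoʳ-≤; ≤-trans; module ≤-Reasoning)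
open import Data.Fin using (Fin; zero; suc; toℕ)
open import Data.Bool using (Bool; true; false; not; if_then_else_)
open import Data.Bool.Properties using (not-¬)
import Data.Bool as Bool
open import Data.Integer using (ℤ; +_; -[1+_]; _-_)
import Data.Integer.Properties as ℤ
open import Data.Product using (_×_; _,_; proj₁; proj₂)
open import Data.Sum using (_⊎_; inj₁; inj₂)
open import Data.List using (List; []; _∷_; length; filter; map; allFin)
open import Data.List.Properties
  using (map-cong; map-tabulate; length-tabulate; filter-accept; filter-reject; filter-≐)
open import Function using (_∘_; id; _⇔_; mk⇔; Equivalence)
open import Relation.Nullary using (Dec; does; contradiction)
open import Relation.Nullary.Decidable using (True; toWitness; from-no; _×-dec_)
open import Relation.Unary using (Pred; Decidable)
open import Relation.Binary.PropositionalEquality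
  using (_≡_; refl; sym; trans; cong; subst; subst₂; cong₂; _≢_; module ≡-Reasoning)

module _ {A B : Set} {ℓ} {P : Pred B ℓ} (P? : Decidable P) (g : A → B) where

  length-filter-map : ∀ xs → length (filter P? (map g xs)) ≡ length (filter (P? ∘ g) xs)
  length-filter-map []       = refl
  length-filter-map (x ∷ xs) with does (P? (g x))
  ... | true  = cong suc (length-filter-map xs)
  ... | false = length-filter-map xs

module _ {A : Set} (h : A → Bool) where

  length-filter-≟-not : ∀ b xs →
    length (filter (λ x → h x Bool.≟ b) xs) + length (filter (λ x → h x Bool.≟ not b) xs) ≡ length xs
  length-filter-≟-not b [] = refl
  length-filter-≟-not b (x ∷ xs) with h x | b
  ... | false | false = cong suc (length-filter-≟-not false xs)
  ... | true  | true  = cong suc (length-filter-≟-not true xs)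
  ... | false | true  = trans (+-suc _ _) (cong suc (length-filter-≟-not true xs))
  ... | true  | false = trans (+-suc _ _) (cong suc (length-filter-≟-not false xs))

module _ {A : Set} (g : A → ℤ) (g-range : ∀ x → g x ≡ + 1 ⊎ g x ≡ -[1+ 0 ] ⊎ g x ≡ + 0) where

  private
    count : ℤ → List A → ℕ
    count c xs = length (filter (λ x → g x ℤ.≟ c) xs)

  length-filter-≟-trichotomy : ∀ xs → count (+ 1) xs + count -[1+ 0 ] xs + count (+ 0) xs ≡ length xs
  length-filter-≟-trichotomy [] = refl
  length-filter-≟-trichotomy (x ∷ xs) with g x | g-range x
  ... | _ | inj₁ refl = cong suc (length-filter-≟-trichotomy xs)
  ... | _ | inj₂ (inj₁ refl) =
    trans (cong (_+ count (+ 0) xs) (+-suc (count (+ 1) xs) _)) (cong suc (length-filter-≟-trichotomy xs))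
  ... | _ | inj₂ (inj₂ refl) = trans (+-suc _ _) (cong suc (length-filter-≟-trichotomy xs))

val-diff-range : ∀ a b → val a - val b ≡ + 1 ⊎ val a - val b ≡ -[1+ 0 ] ⊎ val a - val b ≡ + 0
val-diff-range false false = inj₂ (inj₂ refl)
val-diff-range false true  = inj₂ (inj₁ refl)
val-diff-range true  false = inj₁ refl
val-diff-range true  true  = inj₂ (inj₂ refl)

val-diff≡0⇔≡ : ∀ a b → (val a - val b ≡ + 0) ⇔ (a ≡ b)
val-diff≡0⇔≡ false false = mk⇔ (λ _ → refl) (λ _ → refl)
val-diff≡0⇔≡ false true  = mk⇔ (λ ()) (λ ())
val-diff≡0⇔≡ true  false = mk⇔ (λ ()) (λ ())
val-diff≡0⇔≡ true  true  = mk⇔ (λ _ → refl) (λ _ → refl)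

allFin-suc : ∀ m → allFin (suc m) ≡ zero ∷ map suc (allFin m)
allFin-suc m = cong (zero ∷_) (sym (map-tabulate id suc))

module Star {m : ℕ} (o : Fin m → Bool) (f : Fin (suc m) → Bool) where

  star : Digraph (suc m)
  star = starOrientation m o

  leafArc : Fin m → Fin (suc m) × Fin (suc m)
  leafArc i = if o i then (zero , suc i) else (suc i , zero)

  leafArcLabel : Fin m → ℤ
  leafArcLabel i = arcLabel f (leafArc i)

  leafArcLabel-± : ∀ i → leafArcLabel i ≡ val (f (suc i)) - val (f zero)
                       ⊎ leafArcLabel i ≡ val (f zero) - val (f (suc i))
  leafArcLabel-± i with o i
  ... | true  = inj₁ refl
  ... | false = inj₂ refl

  leafArcLabel-range : ∀ i → leafArcLabel i ≡ + 1 ⊎ leafArcLabel i ≡ -[1+ 0 ] ⊎ leafArcLabel i ≡ + 0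
  leafArcLabel-range i with leafArcLabel-± i
  ... | inj₁ eq rewrite eq = val-diff-range (f (suc i)) (f zero)
  ... | inj₂ eq rewrite eq = val-diff-range (f zero) (f (suc i))

  -- The left-hand side of starArc≗leafArc is the arc built locally inside starOrientation, which
  -- cannot be named; the mutual block lets Agda infer it from the use in starOrientation≡leafArcs.
  mutual
    starOrientation≡leafArcs : star ≡ map leafArc (allFin m)
    starOrientation≡leafArcs = map-cong starArc≗leafArc (allFin m)

    starArc≗leafArc : ∀ i → _ ≡ leafArc i
    starArc≗leafArc i with o i
    ... | true  = refl
    ... | false = refl

  countArc≡leafCount : ∀ c → countArc f star c ≡ length (filter (λ i → leafArcLabel i ℤ.≟ c) (allFin m))
  countArc≡leafCount c = trans (cong (length ∘ filter P?) starOrientation≡leafArcs)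
                               (length-filter-map P? leafArc (allFin m))
    where P? = λ a → arcLabel f a ℤ.≟ c

  agreeing disagreeing : ℕ
  agreeing    = countLabel (f ∘ suc) (f zero)
  disagreeing = countLabel (f ∘ suc) (not (f zero))

  leafArcLabel≡0⇔agrees : ∀ i → (leafArcLabel i ≡ + 0) ⇔ (f (suc i) ≡ f zero)
  leafArcLabel≡0⇔agrees i with leafArcLabel-± i
  ... | inj₁ eq rewrite eq = val-diff≡0⇔≡ (f (suc i)) (f zero)
  ... | inj₂ eq rewrite eq = mk⇔ (sym ∘ to) (from ∘ sym)
    where open Equivalence (val-diff≡0⇔≡ (f zero) (f (suc i)))

  countArc-zero : countArc f star (+ 0) ≡ agreeing
  countArc-zero = trans (countArc≡leafCount (+ 0))
    (cong length (filter-≐ (λ i → leafArcLabel i ℤ.≟ + 0) (λ i → f (suc i) Bool.≟ f zero)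
                           ((λ {i} → to (leafArcLabel≡0⇔agrees i)) , (λ {i} → from (leafArcLabel≡0⇔agrees i)))
                           (allFin m)))
    where open Equivalence

  countArc-total : countArc f star (+ 1) + countArc f star -[1+ 0 ] + countArc f star (+ 0) ≡ m
  countArc-total = begin
    countArc f star (+ 1) + countArc f star -[1+ 0 ] + countArc f star (+ 0)
      ≡⟨ cong₂ _+_ (cong₂ _+_ (countArc≡leafCount (+ 1)) (countArc≡leafCount -[1+ 0 ]))
                   (countArc≡leafCount (+ 0)) ⟩
    _ ≡⟨ length-filter-≟-trichotomy leafArcLabel leafArcLabel-range (allFin m) ⟩
    length (allFin m) ≡⟨ length-tabulate id ⟩
    m ∎
    where open ≡-Reasoning

  countLabel-centre : countLabel f (f zero) ≡ suc agreeing
  countLabel-centre = begin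
    countLabel f (f zero)                                  ≡⟨ cong (length ∘ filter P?) (allFin-suc m) ⟩
    length (filter P? (zero ∷ map suc (allFin m)))         ≡⟨ cong length (filter-accept P? refl) ⟩
    suc (length (filter P? (map suc (allFin m))))          ≡⟨ cong suc (length-filter-map P? suc (allFin m)) ⟩
    suc agreeing                                           ∎
    where
    open ≡-Reasoning
    P? = λ v → f v Bool.≟ f zero

  countLabel-other : countLabel f (not (f zero)) ≡ disagreeing
  countLabel-other = begin
    countLabel f (not (f zero))                            ≡⟨ cong (length ∘ filter P?) (allFin-suc m) ⟩
    length (filter P? (zero ∷ map suc (allFin m)))         ≡⟨ cong length (filter-reject P? (not-¬ refl)) ⟩
    length (filter P? (map suc (allFin m)))                ≡⟨ length-filter-map P? suc (allFin m) ⟩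
    disagreeing                                            ∎
    where
    open ≡-Reasoning
    P? = λ v → f v Bool.≟ not (f zero)

  leaves-total : agreeing + disagreeing ≡ m
  leaves-total = trans (length-filter-≟-not (f ∘ suc) (f zero) (allFin m)) (length-tabulate id)

  friendly⇒close : FriendlyV f → Close (suc agreeing) disagreeing
  friendly⇒close friendly = subst₂ Close countLabel-centre countLabel-other (orient (f zero))
    where
    orient : ∀ b → Close (countLabel f b) (countLabel f (not b))
    orient false = friendly
    orient true  = proj₂ friendly , proj₁ friendly

  cordial⇒leafBounds : Cordial23Labeling star f →
    agreeing + agreeing ≤ 2 + disagreeing × disagreeing ≤ 2 + agreeing
  cordial⇒leafBounds (friendly , close₁₀ , _ , close₀₋₁) = z+z≤2+w , proj₂ (friendly⇒close friendly)
    where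
    n₁ n₋₁ : ℕ
    n₁ = countArc f star (+ 1)
    n₋₁ = countArc f star -[1+ 0 ]
    agreeing≤1+n₁ : agreeing ≤ suc n₁
    agreeing≤1+n₁ = subst (_≤ suc n₁) countArc-zero (proj₂ close₁₀)
    agreeing≤1+n₋₁ : agreeing ≤ suc n₋₁
    agreeing≤1+n₋₁ = subst (_≤ suc n₋₁) countArc-zero (proj₁ close₀₋₁)
    n₁+n₋₁≡disagreeing : n₁ + n₋₁ ≡ disagreeing
    n₁+n₋₁≡disagreeing = +-cancelʳ-≡ agreeing _ _ (begin
      n₁ + n₋₁ + agreeing                      ≡⟨ cong (_+_ (n₁ + n₋₁)) countArc-zero ⟨
      n₁ + n₋₁ + countArc f star (+ 0)         ≡⟨ countArc-total ⟩
      m                                        ≡⟨ leaves-total ⟨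
      agreeing + disagreeing                   ≡⟨ +-comm agreeing disagreeing ⟩
      disagreeing + agreeing                   ∎)
      where open ≡-Reasoning
    z+z≤2+w : agreeing + agreeing ≤ 2 + disagreeing
    z+z≤2+w = begin
      agreeing + agreeing  ≤⟨ +-mono-≤ agreeing≤1+n₁ agreeing≤1+n₋₁ ⟩
      suc n₁ + suc n₋₁     ≡⟨ cong suc (+-suc n₁ n₋₁) ⟩
      2 + (n₁ + n₋₁)       ≡⟨ cong (λ n → 2 + n) n₁+n₋₁≡disagreeing ⟩
      2 + disagreeing      ∎
      where open ≤-Reasoning

agreeing≤4 : ∀ {z w} → z + z ≤ 2 + w → w ≤ 2 + z → z ≤ 4
agreeing≤4 {z} z+z≤2+w w≤2+z = +-cancelʳ-≤ z z 4 (≤-trans z+z≤2+w (+-monoʳ-≤ 2 w≤2+z))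

leaves≤10 : ∀ {z w} → z + z ≤ 2 + w → w ≤ 2 + z → z + w ≤ 10
leaves≤10 z+z≤2+w w≤2+z = +-mono-≤ z≤4 (≤-trans w≤2+z (+-monoʳ-≤ 2 z≤4))
  where z≤4 = agreeing≤4 z+z≤2+w w≤2+z

leaves≢9 : ∀ z {w} → z ≤ 4 → z + z ≤ 2 + w → w ≤ 2 + z → z + w ≢ 9
leaves≢9 0 _ _ w≤2+z refl = from-no (9 ≤? 2) w≤2+z
leaves≢9 1 _ _ w≤2+z refl = from-no (8 ≤? 3) w≤2+z
leaves≢9 2 _ _ w≤2+z refl = from-no (7 ≤? 4) w≤2+z
leaves≢9 3 _ _ w≤2+z refl = from-no (6 ≤? 5) w≤2+z
leaves≢9 4 _ z+z≤2+w _ refl = from-no (8 ≤? 7) z+z≤2+w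
leaves≢9 (suc (suc (suc (suc (suc _))))) (s≤s (s≤s (s≤s (s≤s ())))) _ _

cordialStar⇒bounds : ∀ m → StarHasCordialOrientation (suc m) → m ≤ 10 × m ≢ 9
cordialStar⇒bounds m (o , f , cordial) =
  subst (λ n → n ≤ 10 × n ≢ 9) leaves-total
    (leaves≤10 z+z≤2+w w≤2+z , leaves≢9 agreeing (agreeing≤4 z+z≤2+w w≤2+z) z+z≤2+w w≤2+z)
  where
  open Star o f
  z+z≤2+w = proj₁ (cordial⇒leafBounds cordial)
  w≤2+z = proj₂ (cordial⇒leafBounds cordial)

close? : ∀ a b → Dec (Close a b)
close? a b = (a ≤? suc b) ×-dec (b ≤? suc a)

cordial23Labeling? : ∀ {k} (A : Digraph k) (f : Fin k → Bool) → Dec (Cordial23Labeling A f)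
cordial23Labeling? A f =
  close? _ _ ×-dec close? _ _ ×-dec close? _ _ ×-dec close? _ _

firstLeaves : ∀ {m} → ℕ → Fin m → Bool
firstLeaves t i = toℕ i <ᵇ t

-- The centre and the first z leaves get label 0, the other leaves label 1; edges to the first z + a
-- leaves point outwards, so a arcs are labelled 1 and the remaining leaves labelled 1 give -1.
starLabelling : ∀ {m} → ℕ → Fin (suc m) → Bool
starLabelling z zero    = false
starLabelling z (suc i) = not (firstLeaves z i)

cordialStar : ∀ m z a →
  {True (cordial23Labeling? (starOrientation m (firstLeaves (z + a))) (starLabelling z))} →
  StarHasCordialOrientation (suc m)
cordialStar m z a {cordial} = firstLeaves (z + a) , starLabelling z , toWitness cordial

bounds⇒cordialStar : ∀ m → m ≤ 10 → m ≢ 9 → StarHasCordialOrientation (suc m)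
bounds⇒cordialStar 0  _ _ = cordialStar 0 0 0
bounds⇒cordialStar 1  _ _ = cordialStar 1 0 0
bounds⇒cordialStar 2  _ _ = cordialStar 2 0 1
bounds⇒cordialStar 3  _ _ = cordialStar 3 1 1
bounds⇒cordialStar 4  _ _ = cordialStar 4 1 1
bounds⇒cordialStar 5  _ _ = cordialStar 5 2 1
bounds⇒cordialStar 6  _ _ = cordialStar 6 2 2
bounds⇒cordialStar 7  _ _ = cordialStar 7 3 2
bounds⇒cordialStar 8  _ _ = cordialStar 8 3 2
bounds⇒cordialStar 9  _ m≢9 = contradiction refl m≢9
bounds⇒cordialStar 10 _ _ = cordialStar 10 4 3
bounds⇒cordialStar (suc (suc (suc (suc (suc (suc (suc (suc (suc (suc (suc _)))))))))))
  (s≤s (s≤s (s≤s (s≤s (s≤s (s≤s (s≤s (s≤s (s≤s (s≤s ())))))))))) _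

mainTheorem2 : (n : ℕ) → 1 ≤ n →
    (StarHasCordialOrientation n ⇔ (n ≤ 11 × n ≢ 10))
mainTheorem2 (suc m) _ = mk⇔
  (λ cordial → let (m≤10 , m≢9) = cordialStar⇒bounds m cordial in s≤s m≤10 , m≢9 ∘ suc-injective)
  (λ (1+m≤11 , 1+m≢10) → bounds⇒cordialStar m (s≤s⁻¹ 1+m≤11) (1+m≢10 ∘ cong suc))
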